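{- Let $G$ be a graph containing six distinct vertices $a,b,c,d,e,f$ such that the edges of $G$ among $\{a,b,c,d,e,f\}$ are exactly $ab, ac, bc, bd, cd, ce, de, df, ef$, and such that the only edges of $G$ joining $\{a,b,c,d,e,f\}$ to vertices outside this set are incident with $a$, $b$ or $d$ (each of $a,b,d$ may have any number of such external neighbors; $c,e,f$ have none). If $S$ is a DET:OLD set of $G$, then $\{a,b,c,d,e,f\}\subseteq S$ and $b$ has at least one neighbor in $S\setminus\{a,b,c,d,e,f\}$.
   Context: For a graph $G$ and $v\in V(G)$, $N(v)$ is the open neighborhood of $v$. For $S\subseteq V(G)$ write $N_S(v)=N(v)\cap S$. A set $S\subseteq V(G)$ is a DET:OLD set of $G$ if (1) every vertex $v\in V(G)$ satisfies $|N_S(v)|\ge 2$, and (2) every pair of distinct vertices $u,v\in V(G)$ satisfies $|N_S(u)\setminus N_S(v)|\ge 2$ or $|N_S(v)\setminus N_S(u)|\ge 2$. -}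

module Defs where

open import Data.Nat using (ℕ; _≤_)
open import Data.Bool using (Bool; true; false)
open import Data.Fin using (Fin)
open import Data.Fin.Subset using (Subset; _∩_; _─_; ∣_∣)
open import Data.Vec using (tabulate)
open import Data.Sum using (_⊎_)
open import Relation.Binary.PropositionalEquality using (_≡_)
open import Relation.Nullary using (¬_)

record Graph (n : ℕ) : Set where
  field
    adj   : Fin n → Fin n → Bool
    sym   : ∀ u v → adj u v ≡ adj v u
    irrefl : ∀ v → adj v v ≡ false

open Graph public

Edge : ∀ {n} → Graph n → Fin n → Fin n → Set
Edge G u v = adj G u v ≡ true

N : ∀ {n} → Graph n → Fin n → Subset n
N G v = tabulate (adj G v)

N[_] : ∀ {n} → Graph n → Subset n → Fin n → Subset n
N[ G ] S v = N G v ∩ S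

record DETOLD {n : ℕ} (G : Graph n) (S : Subset n) : Set where
  field
    dom : ∀ v → 2 ≤ ∣ N[ G ] S v ∣
    sep : ∀ u v → ¬ (u ≡ v) →
          (2 ≤ ∣ N[ G ] S u ─ N[ G ] S v ∣) ⊎ (2 ≤ ∣ N[ G ] S v ─ N[ G ] S u ∣)

{-# OPTIONS --safe #-}

-- Since N(f) = {d, e}, domination of f forces d, e ∈ S. For each of the pairs
-- (e, f), (c, f) and (b, e), one of the two differences of S-neighbourhoods is
-- contained in a single vertex, so separation forces the other to contain two
-- vertices. As c, e, f have no outside neighbours, N_S(e) ∖ N_S(f) ⊆ {c, f} and
-- N_S(c) ∖ N_S(f) ⊆ {a, b}, which puts c, f and then a, b into S; finally
-- N_S(b) ∖ N_S(e) avoids c, d, e, f, so besides a it contains an outside vertex.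
module Submission where

open import Defs hiding (sym)
open import Data.Nat using (ℕ; _≤_)
open import Data.Nat.Properties using (≤-trans; <-irrefl)
open import Data.Bool using (true; false)
open import Data.Fin using (Fin; _≟_)
open import Data.Fin.Subset using (Subset; _∈_; _∉_; _─_; _-_; ∣_∣; ⁅_⁆; _⊆_; outside)
open import Data.Fin.Subset.Properties
  using (nonempty?; p─q⊆p; x∈p∧x≢y⇒x∈p-y; x∉⁅y⁆⇒x≢y; x∈⁅x⁆; p⊆q⇒∣p∣≤∣q∣; ∣⁅x⁆∣≡1; x∈p∩q⁺; x∈p∩q⁻)
open import Data.Vec using (_∷_; here; there)
open import Data.Vec.Properties using ([]=⇒lookup; lookup⇒[]=; lookup∘tabulate)
open import Data.Product using (_×_; _,_; proj₁; proj₂; ∃-syntax)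
import Data.Product as Product
open import Data.Sum using (_⊎_; inj₁; inj₂)
import Data.Sum as Sum
open import Data.Empty using (⊥-elim)
open import Relation.Nullary using (¬_; yes; no; contradiction)
open import Function using (_∘_)
open import Relation.Binary.PropositionalEquality using (_≡_; _≢_; refl; sym; trans; subst)

x∈p─q⇒x∉q : ∀ {n} {p q : Subset n} {x : Fin n} → x ∈ p ─ q → x ∉ q
x∈p─q⇒x∉q {p = _ ∷ _} {outside ∷ _} here ()
x∈p─q⇒x∉q {p = _ ∷ _} {_ ∷ _} (there x∈p─q) (there x∈q) = x∈p─q⇒x∉q x∈p─q x∈q

module _ {n : ℕ} where

  x∈p─q∧y∈q⇒x≢y : {p q : Subset n} {x y : Fin n} → x ∈ p ─ q → y ∈ q → x ≢ y
  x∈p─q∧y∈q⇒x≢y x∈p─q y∈q refl = x∈p─q⇒x∉q x∈p─q y∈q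

  2≤∣p∣⇒p⊈⁅y⁆ : {p : Subset n} {y : Fin n} → 2 ≤ ∣ p ∣ → ¬ (p ⊆ ⁅ y ⁆)
  2≤∣p∣⇒p⊈⁅y⁆ {p} {y} 2≤∣p∣ p⊆⁅y⁆ =
    <-irrefl refl (≤-trans 2≤∣p∣ (subst (∣ p ∣ ≤_) (∣⁅x⁆∣≡1 y) (p⊆q⇒∣p∣≤∣q∣ p⊆⁅y⁆)))

  2≤∣p∣⇒∃x∈p∧x≢y : {p : Subset n} → 2 ≤ ∣ p ∣ → (y : Fin n) → ∃[ x ] x ∈ p × x ≢ y
  2≤∣p∣⇒∃x∈p∧x≢y {p} 2≤∣p∣ y with nonempty? (p - y)
  ... | yes (x , x∈p-y) = x , p─q⊆p p ⁅ y ⁆ x∈p-y , x∉⁅y⁆⇒x≢y (x∈p─q⇒x∉q x∈p-y)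
  ... | no p-y-empty = ⊥-elim (2≤∣p∣⇒p⊈⁅y⁆ 2≤∣p∣ p⊆⁅y⁆)
    where
    p⊆⁅y⁆ : p ⊆ ⁅ y ⁆
    p⊆⁅y⁆ {x} x∈p with x ≟ y
    ... | yes refl = x∈⁅x⁆ x
    ... | no x≢y = ⊥-elim (p-y-empty (x , x∈p∧x≢y⇒x∈p-y x∈p x≢y))

  2≤∣p∣∧p⊆⁅u,v⁆⇒u,v∈p : {p : Subset n} {u v : Fin n} → 2 ≤ ∣ p ∣ →
                         (∀ {x} → x ∈ p → x ≡ u ⊎ x ≡ v) → u ∈ p × v ∈ p
  2≤∣p∣∧p⊆⁅u,v⁆⇒u,v∈p {p} 2≤∣p∣ p⊆⁅u,v⁆ = first∈p p⊆⁅u,v⁆ , first∈p (Sum.swap ∘ p⊆⁅u,v⁆)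
    where
    first∈p : ∀ {w w′} → (∀ {x} → x ∈ p → x ≡ w ⊎ x ≡ w′) → w ∈ p
    first∈p {w′ = w′} p⊆⁅w,w′⁆ with 2≤∣p∣⇒∃x∈p∧x≢y 2≤∣p∣ w′
    ... | x , x∈p , x≢w′ with p⊆⁅w,w′⁆ x∈p
    ...   | inj₁ refl = x∈p
    ...   | inj₂ x≡w′ = contradiction x≡w′ x≢w′

module Neighbourhood {n : ℕ} (G : Graph n) where

  ∼-sym : {u v : Fin n} → Edge G u v → Edge G v u
  ∼-sym {u} {v} u∼v = trans (Graph.sym G v u) u∼v

  ≁-sym : {u v : Fin n} → adj G u v ≡ false → adj G v u ≡ false
  ≁-sym {u} {v} u≁v = trans (Graph.sym G v u) u≁v

  ≁⇒¬∼ : {u v : Fin n} → adj G u v ≡ false → ¬ Edge G u v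
  ≁⇒¬∼ u≁v u∼v with trans (sym u∼v) u≁v
  ... | ()

  ∼∧≁⇒≢ : {u x y : Fin n} → Edge G u x → adj G u y ≡ false → x ≢ y
  ∼∧≁⇒≢ u∼x u≁x refl = ≁⇒¬∼ u≁x u∼x

  x∈N⇒∼ : {v x : Fin n} → x ∈ N G v → Edge G v x
  x∈N⇒∼ {v} {x} x∈N = trans (sym (lookup∘tabulate (adj G v) x)) ([]=⇒lookup x∈N)

  ∼⇒x∈N : {v x : Fin n} → Edge G v x → x ∈ N G v
  ∼⇒x∈N {v} {x} v∼x = lookup⇒[]= x (N G v) (trans (lookup∘tabulate (adj G v) x) v∼x)

  module Restricted (S : Subset n) where

    Nₛ : Fin n → Subset n
    Nₛ = N[ G ] S

    x∈Nₛ⇒∼∧x∈S : {v x : Fin n} → x ∈ Nₛ v → Edge G v x × x ∈ S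
    x∈Nₛ⇒∼∧x∈S {v} x∈Nₛ = Product.map₁ x∈N⇒∼ (x∈p∩q⁻ (N G v) S x∈Nₛ)

    ∼∧x∈S⇒x∈Nₛ : {v x : Fin n} → Edge G v x → x ∈ S → x ∈ Nₛ v
    ∼∧x∈S⇒x∈Nₛ v∼x x∈S = x∈p∩q⁺ (∼⇒x∈N v∼x , x∈S)

    x∈Nₛ─⇒∼∧x∈S : {v x : Fin n} {q : Subset n} → x ∈ Nₛ v ─ q → Edge G v x × x ∈ S
    x∈Nₛ─⇒∼∧x∈S {v} {q = q} x∈Nₛ─q = x∈Nₛ⇒∼∧x∈S (p─q⊆p (Nₛ v) q x∈Nₛ─q)

    x∈─Nₛ∧∼⇒x≢ : {v w x y : Fin n} → x ∈ Nₛ v ─ Nₛ w → Edge G w y → y ∈ S → x ≢ y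
    x∈─Nₛ∧∼⇒x≢ x∈Nₛ─Nₛw w∼y y∈S = x∈p─q∧y∈q⇒x≢y x∈Nₛ─Nₛw (∼∧x∈S⇒x∈Nₛ w∼y y∈S)

    sep-other-side : DETOLD G S → {u v w : Fin n} → u ≢ v →
                     (∀ {x} → x ∈ Nₛ v ─ Nₛ u → x ≡ w) → 2 ≤ ∣ Nₛ u ─ Nₛ v ∣
    sep-other-side D {u} {v} {w} u≢v ─⊆⁅w⁆ with DETOLD.sep D u v u≢v
    ... | inj₁ 2≤∣u─v∣ = 2≤∣u─v∣
    ... | inj₂ 2≤∣v─u∣ = contradiction (λ {x} → x∈⁅⁆ ∘ ─⊆⁅w⁆ {x}) (2≤∣p∣⇒p⊈⁅y⁆ 2≤∣v─u∣)
      where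
      x∈⁅⁆ : ∀ {x} → x ≡ w → x ∈ ⁅ w ⁆
      x∈⁅⁆ refl = x∈⁅x⁆ w

module Gadget {n : ℕ} {G : Graph n} {S : Subset n} (D : DETOLD G S) {a b c d e f : Fin n}
  (b≢e : b ≢ e) (c≢f : c ≢ f) (e≢f : e ≢ f)
  (a≁e : adj G a e ≡ false) (a≁f : adj G a f ≡ false)
  (b∼c : Edge G b c) (b∼d : Edge G b d) (b≁e : adj G b e ≡ false) (b≁f : adj G b f ≡ false)
  (c∼d : Edge G c d) (c∼e : Edge G c e) (c≁f : adj G c f ≡ false)
  (d∼e : Edge G d e) (d∼f : Edge G d f) (e∼f : Edge G e f)
  (cef-closed : ∀ x → x ≢ a → x ≢ b → x ≢ c → x ≢ d → x ≢ e → x ≢ f →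
                (adj G c x ≡ false) × (adj G e x ≡ false) × (adj G f x ≡ false))
  where

  open Neighbourhood G
  open Restricted S

  N-f : ∀ {x} → Edge G f x → x ≡ d ⊎ x ≡ e
  N-f {x} f∼x with x ≟ d | x ≟ e
  ... | yes x≡d | _       = inj₁ x≡d
  ... | no _    | yes x≡e = inj₂ x≡e
  ... | no x≢d  | no x≢e  = ⊥-elim (≁⇒¬∼ (proj₂ (proj₂ (cef-closed x x≢a x≢b x≢c x≢d x≢e x≢f))) f∼x)
    where
    x≢a : x ≢ a
    x≢a = ∼∧≁⇒≢ f∼x (≁-sym a≁f)
    x≢b : x ≢ b
    x≢b = ∼∧≁⇒≢ f∼x (≁-sym b≁f)
    x≢c : x ≢ c
    x≢c = ∼∧≁⇒≢ f∼x (≁-sym c≁f)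
    x≢f : x ≢ f
    x≢f = ∼∧≁⇒≢ f∼x (irrefl G f)

  N-e : ∀ {x} → Edge G e x → x ≡ c ⊎ x ≡ d ⊎ x ≡ f
  N-e {x} e∼x with x ≟ c | x ≟ d | x ≟ f
  ... | yes x≡c | _       | _       = inj₁ x≡c
  ... | no _    | yes x≡d | _       = inj₂ (inj₁ x≡d)
  ... | no _    | no _    | yes x≡f = inj₂ (inj₂ x≡f)
  ... | no x≢c  | no x≢d  | no x≢f  = ⊥-elim (≁⇒¬∼ (proj₁ (proj₂ (cef-closed x x≢a x≢b x≢c x≢d x≢e x≢f))) e∼x)
    where
    x≢a : x ≢ a
    x≢a = ∼∧≁⇒≢ e∼x (≁-sym a≁e)
    x≢b : x ≢ b
    x≢b = ∼∧≁⇒≢ e∼x (≁-sym b≁e)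
    x≢e : x ≢ e
    x≢e = ∼∧≁⇒≢ e∼x (irrefl G e)

  N-c : ∀ {x} → Edge G c x → x ≡ a ⊎ x ≡ b ⊎ x ≡ d ⊎ x ≡ e
  N-c {x} c∼x with x ≟ a | x ≟ b | x ≟ d | x ≟ e
  ... | yes x≡a | _       | _       | _       = inj₁ x≡a
  ... | no _    | yes x≡b | _       | _       = inj₂ (inj₁ x≡b)
  ... | no _    | no _    | yes x≡d | _       = inj₂ (inj₂ (inj₁ x≡d))
  ... | no _    | no _    | no _    | yes x≡e = inj₂ (inj₂ (inj₂ x≡e))
  ... | no x≢a  | no x≢b  | no x≢d  | no x≢e  = ⊥-elim (≁⇒¬∼ (proj₁ (cef-closed x x≢a x≢b x≢c x≢d x≢e x≢f)) c∼x)
    where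
    x≢c : x ≢ c
    x≢c = ∼∧≁⇒≢ c∼x (irrefl G c)
    x≢f : x ≢ f
    x≢f = ∼∧≁⇒≢ c∼x c≁f

  d∈S×e∈S : d ∈ S × e ∈ S
  d∈S×e∈S with 2≤∣p∣∧p⊆⁅u,v⁆⇒u,v∈p (DETOLD.dom D f) (N-f ∘ proj₁ ∘ x∈Nₛ⇒∼∧x∈S)
  ... | d∈Nₛf , e∈Nₛf = proj₂ (x∈Nₛ⇒∼∧x∈S d∈Nₛf) , proj₂ (x∈Nₛ⇒∼∧x∈S e∈Nₛf)

  d∈S : d ∈ S
  d∈S = proj₁ d∈S×e∈S

  e∈S : e ∈ S
  e∈S = proj₂ d∈S×e∈S

  in-S : {v w x : Fin n} → x ∈ Nₛ v ─ Nₛ w → x ∈ S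
  in-S = proj₂ ∘ x∈Nₛ─⇒∼∧x∈S

  Nₛf─Nₛe⊆⁅e⁆ : ∀ {x} → x ∈ Nₛ f ─ Nₛ e → x ≡ e
  Nₛf─Nₛe⊆⁅e⁆ x∈ with N-f (proj₁ (x∈Nₛ─⇒∼∧x∈S x∈))
  ... | inj₁ x≡d = contradiction x≡d (x∈─Nₛ∧∼⇒x≢ x∈ (∼-sym d∼e) d∈S)
  ... | inj₂ x≡e = x≡e

  Nₛe─Nₛf⊆⁅c,f⁆ : ∀ {x} → x ∈ Nₛ e ─ Nₛ f → x ≡ c ⊎ x ≡ f
  Nₛe─Nₛf⊆⁅c,f⁆ x∈ with N-e (proj₁ (x∈Nₛ─⇒∼∧x∈S x∈))
  ... | inj₁ x≡c = inj₁ x≡c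
  ... | inj₂ (inj₁ x≡d) = contradiction x≡d (x∈─Nₛ∧∼⇒x≢ x∈ (∼-sym d∼f) d∈S)
  ... | inj₂ (inj₂ x≡f) = inj₂ x≡f

  c∈S×f∈S : c ∈ S × f ∈ S
  c∈S×f∈S with 2≤∣p∣∧p⊆⁅u,v⁆⇒u,v∈p (sep-other-side D e≢f Nₛf─Nₛe⊆⁅e⁆) Nₛe─Nₛf⊆⁅c,f⁆
  ... | c∈ , f∈ = in-S c∈ , in-S f∈

  c∈S : c ∈ S
  c∈S = proj₁ c∈S×f∈S

  f∈S : f ∈ S
  f∈S = proj₂ c∈S×f∈S

  Nₛf─Nₛc⊆⁅d⁆ : ∀ {x} → x ∈ Nₛ f ─ Nₛ c → x ≡ d
  Nₛf─Nₛc⊆⁅d⁆ x∈ with N-f (proj₁ (x∈Nₛ─⇒∼∧x∈S x∈))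
  ... | inj₁ x≡d = x≡d
  ... | inj₂ x≡e = contradiction x≡e (x∈─Nₛ∧∼⇒x≢ x∈ c∼e e∈S)

  Nₛc─Nₛf⊆⁅a,b⁆ : ∀ {x} → x ∈ Nₛ c ─ Nₛ f → x ≡ a ⊎ x ≡ b
  Nₛc─Nₛf⊆⁅a,b⁆ x∈ with N-c (proj₁ (x∈Nₛ─⇒∼∧x∈S x∈))
  ... | inj₁ x≡a = inj₁ x≡a
  ... | inj₂ (inj₁ x≡b) = inj₂ x≡b
  ... | inj₂ (inj₂ (inj₁ x≡d)) = contradiction x≡d (x∈─Nₛ∧∼⇒x≢ x∈ (∼-sym d∼f) d∈S)
  ... | inj₂ (inj₂ (inj₂ x≡e)) = contradiction x≡e (x∈─Nₛ∧∼⇒x≢ x∈ (∼-sym e∼f) e∈S)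

  a∈S×b∈S : a ∈ S × b ∈ S
  a∈S×b∈S with 2≤∣p∣∧p⊆⁅u,v⁆⇒u,v∈p (sep-other-side D c≢f Nₛf─Nₛc⊆⁅d⁆) Nₛc─Nₛf⊆⁅a,b⁆
  ... | a∈ , b∈ = in-S a∈ , in-S b∈

  a∈S : a ∈ S
  a∈S = proj₁ a∈S×b∈S

  b∈S : b ∈ S
  b∈S = proj₂ a∈S×b∈S

  Nₛe─Nₛb⊆⁅f⁆ : ∀ {x} → x ∈ Nₛ e ─ Nₛ b → x ≡ f
  Nₛe─Nₛb⊆⁅f⁆ x∈ with N-e (proj₁ (x∈Nₛ─⇒∼∧x∈S x∈))
  ... | inj₁ x≡c = contradiction x≡c (x∈─Nₛ∧∼⇒x≢ x∈ b∼c c∈S)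
  ... | inj₂ (inj₁ x≡d) = contradiction x≡d (x∈─Nₛ∧∼⇒x≢ x∈ b∼d d∈S)
  ... | inj₂ (inj₂ x≡f) = x≡f

  b-has-outer-neighbour-in-S : ∃[ x ] (x ∈ S × Edge G b x ×
                                 x ≢ a × x ≢ b × x ≢ c × x ≢ d × x ≢ e × x ≢ f)
  b-has-outer-neighbour-in-S with 2≤∣p∣⇒∃x∈p∧x≢y {p = Nₛ b ─ Nₛ e} (sep-other-side D b≢e Nₛe─Nₛb⊆⁅f⁆) a
  ... | x , x∈ , x≢a =
    x , in-S x∈ , b∼x , x≢a , ∼∧≁⇒≢ b∼x (irrefl G b) ,
    x∈─Nₛ∧∼⇒x≢ x∈ (∼-sym c∼e) c∈S , x∈─Nₛ∧∼⇒x≢ x∈ (∼-sym d∼e) d∈S ,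
    ∼∧≁⇒≢ b∼x b≁e , x∈─Nₛ∧∼⇒x≢ x∈ e∼f f∈S
    where
    b∼x : Edge G b x
    b∼x = proj₁ (x∈Nₛ─⇒∼∧x∈S x∈)

lemma5 : ∀ {n : ℕ} (G : Graph n) (S : Subset n) (a b c d e f : Fin n) →
    -- the six vertices are pairwise distinct
    a ≢ b → a ≢ c → a ≢ d → a ≢ e → a ≢ f →
    b ≢ c → b ≢ d → b ≢ e → b ≢ f →
    c ≢ d → c ≢ e → c ≢ f →
    d ≢ e → d ≢ f →
    e ≢ f →
    -- edges among {a,…,f} are exactly ab, ac, bc, bd, cd, ce, de, df, ef
    adj G a b ≡ true → adj G a c ≡ true → adj G a d ≡ false →
    adj G a e ≡ false → adj G a f ≡ false →
    adj G b c ≡ true → adj G b d ≡ true → adj G b e ≡ false →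
    adj G b f ≡ false →
    adj G c d ≡ true → adj G c e ≡ true → adj G c f ≡ false →
    adj G d e ≡ true → adj G d f ≡ true →
    adj G e f ≡ true →
    -- c, e, f have no neighbours outside {a,…,f}
    (∀ x → x ≢ a → x ≢ b → x ≢ c → x ≢ d → x ≢ e → x ≢ f →
      (adj G c x ≡ false) × (adj G e x ≡ false) × (adj G f x ≡ false)) →
    DETOLD G S →
    (a ∈ S) × (b ∈ S) × (c ∈ S) × (d ∈ S) × (e ∈ S) × (f ∈ S) ×
    (∃[ x ] (x ∈ S × adj G b x ≡ true ×
      x ≢ a × x ≢ b × x ≢ c × x ≢ d × x ≢ e × x ≢ f))
lemma5 G S a b c d e f _ _ _ _ _ _ _ b≢e _ _ _ c≢f _ _ e≢f
       _ _ _ a≁e a≁f b∼c b∼d b≁e b≁f c∼d c∼e c≁f d∼e d∼f e∼f cef-closed D =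
  a∈S , b∈S , c∈S , d∈S , e∈S , f∈S , b-has-outer-neighbour-in-S
  where
  open Gadget D b≢e c≢f e≢f a≁e a≁f b∼c b∼d b≁e b≁f c∼d c∼e c≁f d∼e d∼f e∼f cef-closed
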